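{- For any integers $n\geq 2$ and $r\geq 2$, there exists a $2$-connected multigraph $G$ with $|V(G)|=2n$ and $\Delta(G)=r$ such that $G$ admits an interval coloring and $W(G)=1+n(r-1)$.
   Context: Multigraphs are finite and may have multiple edges but no loops. For a positive integer $t$, an interval $t$-coloring of a multigraph $G$ is a proper edge coloring $\alpha:E(G)\to\{1,\dots,t\}$ in which every color $1,\dots,t$ is used and, for every vertex $v$, the set of colors on the edges incident to $v$ is an interval of consecutive integers. For a multigraph $G$ having an interval coloring, $W(G)$ denotes the maximum $t$ such that $G$ has an interval $t$-coloring. $\Delta(G)$ is the maximum degree. -}

module Defs where

open import Data.Unit using (⊤)
open import Data.Nat using (ℕ; zero; suc; _+_; _*_; _≤_; _<_)
open import Data.Fin using (Fin)
open import Data.Product using (_×_; _,_; proj₁; proj₂; Σ; ∃)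
open import Data.Sum using (_⊎_)
open import Data.List using (List; length; filter)
open import Data.Fin.Base using ()
open import Data.List.Base using ()
open import Relation.Binary.PropositionalEquality using (_≡_)
open import Relation.Nullary using (¬_; Dec)
open import Data.Fin.Properties using (_≟_)
open import Data.Sum.Properties using ()
open import Relation.Nullary.Decidable using (_⊎-dec_)
open import Data.List using (allFin)

record Multigraph : Set where
  field
    nV    : ℕ
    nE    : ℕ
    ends  : Fin nE → Fin nV × Fin nV
    loopless : ∀ e → ¬ (proj₁ (ends e) ≡ proj₂ (ends e))

open Multigraph public

Incident : (G : Multigraph) → Fin (nE G) → Fin (nV G) → Set
Incident G e v = (proj₁ (ends G e) ≡ v) ⊎ (proj₂ (ends G e) ≡ v)

incident? : (G : Multigraph) → (v : Fin (nV G)) → (e : Fin (nE G)) → Dec (Incident G e v)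
incident? G v e = (proj₁ (ends G e) ≟ v) ⊎-dec (proj₂ (ends G e) ≟ v)

degree : (G : Multigraph) → Fin (nV G) → ℕ
degree G v = length (filter (incident? G v) (allFin (nE G)))

MaxDegree : Multigraph → ℕ → Set
MaxDegree G r = (∀ v → degree G v ≤ r) × ∃ (λ v → degree G v ≡ r)

data Reach (G : Multigraph) (P : Fin (nV G) → Set) : Fin (nV G) → Fin (nV G) → Set where
  here : ∀ {u} → P u → Reach G P u u
  step : ∀ {u w x} (e : Fin (nE G)) → P u → Incident G e u → Incident G e w →
         Reach G P w x → Reach G P u x

ConnectedOn : (G : Multigraph) → (Fin (nV G) → Set) → Set
ConnectedOn G P = ∀ u v → P u → P v → Reach G P u v

Connected : Multigraph → Set
Connected G = ConnectedOn G (λ _ → ⊤)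

TwoConnected : Multigraph → Set
TwoConnected G = (3 ≤ nV G) × Connected G × (∀ x → ConnectedOn G (λ v → ¬ (v ≡ x)))

record IntervalColoring (G : Multigraph) (t : ℕ) : Set where
  field
    α       : Fin (nE G) → ℕ
    inRange : ∀ e → 1 ≤ α e × α e ≤ t
    proper  : ∀ e f v → Incident G e v → Incident G f v → α e ≡ α f → e ≡ f
    allUsed : ∀ c → 1 ≤ c → c ≤ t → ∃ (λ e → α e ≡ c)
    interval : ∀ v e f c → Incident G e v → Incident G f v → α e ≤ c → c ≤ α f →
               ∃ (λ g → Incident G g v × α g ≡ c)

HasIntervalColoring : Multigraph → Set
HasIntervalColoring G = ∃ (λ t → IntervalColoring G t)

WIs : Multigraph → ℕ → Set
WIs G w = IntervalColoring G w × (∀ t → IntervalColoring G t → t ≤ w)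

module Submission where

-- Take the cycle 0, 1, …, 2n − 1 and add r − 2 parallel chords p — 2n − 1 − p for each p < n.
-- Give vertex p the level min p (2n − 1 − p); color the chords at level L by
-- 2 + L(r − 1), …, L(r − 1) + r − 1, and a cycle edge by 1 + (L + 1)(r − 1) where L is the
-- smaller level of its ends, except the edge 2n − 1 — 0, colored 1.  Every vertex of level L
-- then sees exactly the colors 1 + L(r − 1), …, 1 + (L + 1)(r − 1): an interval
-- (1 + n(r − 1))-coloring of an r-regular 2-connected multigraph.
-- Conversely, in any interval coloring of a multigraph of maximum degree r, the largest colors
-- at adjacent vertices differ by at most r − 1, and the ends of the edge colored 1 see only
-- colors ≤ r.  Every edge has an end within distance n − 1 of any vertex, so no color exceeds
-- r + (n − 1)(r − 1) = 1 + n(r − 1).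

open import Defs
open import Data.Nat using (ℕ; zero; suc; _+_; _*_; _∸_; _≤_; _<_; z≤n; s≤s; s≤s⁻¹)
open import Data.Nat.Properties
open import Data.Nat.DivMod using (_%_; [m+kn]%n≡m%n; m<n⇒m%n≡m)
open import Data.Fin using (Fin; toℕ; fromℕ; fromℕ<; inject₁; combine; remQuot)
  renaming (zero to fzero; suc to fsuc)
open import Data.Fin.Properties
  using (toℕ-fromℕ; toℕ-fromℕ<; toℕ-inject₁; toℕ-injective; toℕ<n; remQuot-combine; combine-remQuot)
open import Data.List using (List; []; _∷_; length; map; filter; applyUpTo; allFin)
open import Data.List.Properties using (length-map; length-applyUpTo)
open import Data.List.Membership.Propositional using (_∈_)
open import Data.List.Membership.Propositional.Properties
  using (∈-map⁺; ∈-applyUpTo⁺; ∈-applyUpTo⁻; ∈-filter⁺; ∈-filter⁻; ∈-allFin)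
open import Data.List.Relation.Unary.Any using (here; there)
open import Data.List.Relation.Unary.All using (lookup)
open import Data.List.Relation.Unary.AllPairs using (_∷_)
open import Data.List.Relation.Unary.Unique.Propositional using (Unique)
open import Data.List.Relation.Unary.Unique.Propositional.Properties
  using (applyUpTo⁺₁; filter⁺; allFin⁺)
open import Data.Product using (Σ; _×_; _,_; proj₁; proj₂; ∃; uncurry)
open import Data.Sum using (_⊎_; inj₁; inj₂; swap)
open import Data.Empty using (⊥-elim)
open import Data.Unit using (⊤; tt)
open import Relation.Binary using (tri<; tri≈; tri>)
open import Relation.Nullary using (¬_; Dec; yes; no)
open import Relation.Nullary.Decidable using (_⊎-dec_)
open import Relation.Binary.PropositionalEquality

module _ {A B : Set} where

  private
    remove : ∀ {z : B} (ys : List B) → z ∈ ys → List B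
    remove (y ∷ ys) (here _)  = ys
    remove (y ∷ ys) (there p) = y ∷ remove ys p

    length-remove : ∀ {z : B} (ys : List B) (p : z ∈ ys) → suc (length (remove ys p)) ≡ length ys
    length-remove (y ∷ ys) (here _)  = refl
    length-remove (y ∷ ys) (there p) = cong suc (length-remove ys p)

    ∈-remove : ∀ {z w : B} (ys : List B) (p : z ∈ ys) → w ∈ ys → w ≢ z → w ∈ remove ys p
    ∈-remove (y ∷ ys) (here refl) (here refl) w≢z = ⊥-elim (w≢z refl)
    ∈-remove (y ∷ ys) (here _)    (there q)   _   = q
    ∈-remove (y ∷ ys) (there p)   (here q)    _   = here q
    ∈-remove (y ∷ ys) (there p)   (there q)   w≢z = there (∈-remove ys p q w≢z)

  injection⇒length≤ : (f : A → B) (xs : List A) (ys : List B) → Unique xs →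
                      (∀ {x y} → x ∈ xs → y ∈ xs → f x ≡ f y → x ≡ y) →
                      (∀ {x} → x ∈ xs → f x ∈ ys) → length xs ≤ length ys
  injection⇒length≤ f []       ys _          _   _   = z≤n
  injection⇒length≤ f (x ∷ xs) ys (x∉ ∷ uxs) inj sub =
    subst (suc (length xs) ≤_) (length-remove ys fx∈ys)
      (s≤s (injection⇒length≤ f xs (remove ys fx∈ys) uxs
             (λ p q → inj (there p) (there q))
             (λ y∈xs → ∈-remove ys fx∈ys (sub (there y∈xs))
                          (λ fy≡fx → lookup x∉ y∈xs (sym (inj (there y∈xs) (here refl) fy≡fx))))))
    where fx∈ys = sub (here refl)

module _ (G : Multigraph) (v : Fin (nV G)) where

  incidentEdges : List (Fin (nE G))
  incidentEdges = filter (incident? G v) (allFin (nE G))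

  ∈-incidentEdges⁻ : ∀ {e} → e ∈ incidentEdges → Incident G e v
  ∈-incidentEdges⁻ e∈ = proj₂ (∈-filter⁻ (incident? G v) {xs = allFin (nE G)} e∈)

  ∈-incidentEdges⁺ : ∀ {e} → Incident G e v → e ∈ incidentEdges
  ∈-incidentEdges⁺ {e} ie = ∈-filter⁺ (incident? G v) (∈-allFin e) ie

  degree-≤-window : (α : Fin (nE G) → ℕ) →
                    (∀ e f → Incident G e v → Incident G f v → α e ≡ α f → e ≡ f) →
                    ∀ base w → (∀ e → Incident G e v → ∃ λ o → o < w × α e ≡ base + o) →
                    degree G v ≤ w
  degree-≤-window α proper base w window =
    subst (degree G v ≤_) (length-applyUpTo (base +_) w)
      (injection⇒length≤ α incidentEdges (applyUpTo (base +_) w)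
        (filter⁺ (incident? G v) (allFin⁺ (nE G)))
        (λ p q → proper _ _ (∈-incidentEdges⁻ p) (∈-incidentEdges⁻ q))
        color∈window)
    where
    color∈window : ∀ {e} → e ∈ incidentEdges → α e ∈ applyUpTo (base +_) w
    color∈window e∈ with window _ (∈-incidentEdges⁻ e∈)
    ... | o , o<w , αe≡ = subst (_∈ applyUpTo (base +_) w) (sym αe≡) (∈-applyUpTo⁺ (base +_) o<w)

module _ {G : Multigraph} {t : ℕ} (C : IntervalColoring G t) where
  open IntervalColoring C

  -- The colors α e, …, α f all occur at v, on distinct edges.
  color-span-<-degree : ∀ {v} e f → Incident G e v → Incident G f v → α e ≤ α f →
                         suc (α f) ≤ α e + degree G v
  color-span-<-degree {v} e f ie if αe≤αf = begin
      suc (α f)                  ≡⟨ cong suc (sym (m+[n∸m]≡n αe≤αf)) ⟩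
      suc (α e + (α f ∸ α e))    ≡⟨ sym (+-suc (α e) _) ⟩
      α e + suc (α f ∸ α e)      ≡⟨ cong (α e +_) (sym (length-applyUpTo (α e +_) _)) ⟩
      α e + length gap           ≤⟨ +-monoʳ-≤ (α e) gap≤degree ⟩
      α e + degree G v           ∎
    where
    open ≤-Reasoning
    gap : List ℕ
    gap = applyUpTo (α e +_) (suc (α f ∸ α e))
    gap-occurs : ∀ {c} → c ∈ gap → c ∈ map α (incidentEdges G v)
    gap-occurs c∈ with ∈-applyUpTo⁻ (α e +_) c∈
    ... | i , i<len , refl with interval v e f (α e + i) ie if (m≤m+n (α e) i)
                                  (subst (α e + i ≤_) (m+[n∸m]≡n αe≤αf) (+-monoʳ-≤ (α e) (s≤s⁻¹ i<len)))
    ...   | g , ig , αg≡ = subst (_∈ map α (incidentEdges G v)) αg≡ (∈-map⁺ α (∈-incidentEdges⁺ G v ig))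
    gap≤degree : length gap ≤ degree G v
    gap≤degree = subst (length gap ≤_) (length-map α (incidentEdges G v))
      (injection⇒length≤ (λ c → c) gap _
        (applyUpTo⁺₁ (α e +_) _ (λ i<j _ eq → <⇒≢ i<j (+-cancelˡ-≡ (α e) _ _ eq)))
        (λ _ _ eq → eq) gap-occurs)

data Walk (G : Multigraph) (P : Fin (nV G) → Set) : Fin (nV G) → Fin (nV G) → ℕ → Set where
  here : ∀ {u} → P u → Walk G P u u 0
  step : ∀ {u w x d} (e : Fin (nE G)) → P u → Incident G e u → Incident G e w →
         Walk G P w x d → Walk G P u x (suc d)

module _ {G : Multigraph} {P : Fin (nV G) → Set} where

  walk-start : ∀ {u v d} → Walk G P u v d → P u
  walk-start (here pu)          = pu
  walk-start (step _ pu _ _ _)  = pu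

  _++ʷ_ : ∀ {u v w d d'} → Walk G P u v d → Walk G P v w d' → Walk G P u w (d + d')
  here _              ++ʷ q = q
  step e pu iu iw p   ++ʷ q = step e pu iu iw (p ++ʷ q)

  reverseʷ : ∀ {u v d} → Walk G P u v d → Walk G P v u d
  reverseʷ (here pu) = here pu
  reverseʷ {d = suc d} (step e pu iu iw p) =
    subst (Walk G P _ _) (+-comm d 1) (reverseʷ p ++ʷ step e (walk-start p) iw iu (here pu))

  walk⇒reach : ∀ {u v d} → Walk G P u v d → Reach G P u v
  walk⇒reach (here pu)           = here pu
  walk⇒reach (step e pu iu iw p) = step e pu iu iw (walk⇒reach p)

EdgesWithin : Multigraph → ℕ → Set
EdgesWithin G D = ∀ w e → ∃ λ v → Incident G e v × ∃ λ d → d ≤ D × Walk G (λ _ → ⊤) w v d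

module _ {G : Multigraph} {t : ℕ} (C : IntervalColoring G t) {s : ℕ}
         (degree≤ : ∀ v → degree G v ≤ suc s) where
  open IntervalColoring C

  ColorsAtMost : Fin (nV G) → ℕ → Set
  ColorsAtMost v B = ∀ e → Incident G e v → α e ≤ B

  colors-step : ∀ {u v g B} → Incident G g u → Incident G g v →
                ColorsAtMost u B → ColorsAtMost v (B + s)
  colors-step {u} {v} {g} {B} iu iv bound f if with α f ≤? α g
  ... | yes αf≤αg = ≤-trans αf≤αg (≤-trans (bound g iu) (m≤m+n B s))
  ... | no  αf≰αg = s≤s⁻¹ (begin
      suc (α f)          ≤⟨ color-span-<-degree C g f iv if (<⇒≤ (≰⇒> αf≰αg)) ⟩
      α g + degree G v   ≤⟨ +-mono-≤ (bound g iu) (degree≤ v) ⟩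
      B + suc s          ≡⟨ +-suc B s ⟩
      suc (B + s)        ∎)
    where open ≤-Reasoning

  colors-along-walk : ∀ {P u v d B} → Walk G P u v d →
                      ColorsAtMost u B → ColorsAtMost v (B + d * s)
  colors-along-walk {B = B} (here _) bound =
    subst (ColorsAtMost _) (sym (+-identityʳ B)) bound
  colors-along-walk {d = suc d} {B} (step e _ iu iw p) bound =
    subst (ColorsAtMost _) (+-assoc B s (d * s))
      (colors-along-walk p (colors-step iu iw bound))

  -- Start at an end w of the edge colored 1: all colors at w are at most Δ = s + 1,
  -- and each further step along a walk adds at most s.
  intervalColoring-bound : ∀ {D} → EdgesWithin G D → t ≤ suc s + D * s
  intervalColoring-bound {D} within with 1 ≤? t
  ... | no 1≰t = ≤-trans (s≤s⁻¹ (≰⇒> 1≰t)) z≤n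
  ... | yes 1≤t with allUsed 1 ≤-refl 1≤t | allUsed t 1≤t ≤-refl
  ...   | e₁ , αe₁≡1 | eₜ , αeₜ≡t with within (proj₁ (ends G e₁)) eₜ
  ...     | v , ieₜ , d , d≤D , walk = begin
    t                 ≡⟨ sym αeₜ≡t ⟩
    α eₜ              ≤⟨ colors-along-walk walk colors-at-w eₜ ieₜ ⟩
    suc s + d * s     ≤⟨ +-monoʳ-≤ (suc s) (*-monoˡ-≤ s d≤D) ⟩
    suc s + D * s     ∎
    where
    open ≤-Reasoning
    colors-at-w : ColorsAtMost (proj₁ (ends G e₁)) (suc s)
    colors-at-w f if = s≤s⁻¹ (begin
      suc (α f)           ≤⟨ color-span-<-degree C e₁ f (inj₁ refl) if
                               (subst (_≤ α f) (sym αe₁≡1) (proj₁ (inRange f))) ⟩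
      α e₁ + degree G _   ≤⟨ +-mono-≤ (≤-reflexive αe₁≡1) (degree≤ _) ⟩
      suc (suc s)         ∎)

module Construction (a b : ℕ) where

  n s r top : ℕ
  n   = suc a
  s   = suc b
  r   = suc s
  top = n + a

  2n≡suc-top : 2 * n ≡ suc top
  2n≡suc-top = cong suc (trans (cong (a +_) (+-identityʳ n)) (+-suc a a))

  vertex : (p : ℕ) → p ≤ top → Fin (2 * n)
  vertex p p≤top = fromℕ< (subst (p <_) (sym 2n≡suc-top) (s≤s p≤top))

  toℕ-vertex : ∀ p p≤top → toℕ (vertex p p≤top) ≡ p
  toℕ-vertex p p≤top = toℕ-fromℕ< _

  toℕ≤top : (v : Fin (2 * n)) → toℕ v ≤ top
  toℕ≤top v = s≤s⁻¹ (subst (toℕ v <_) 2n≡suc-top (toℕ<n v))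

  k≤a : (k : Fin n) → toℕ k ≤ a
  k≤a k = s≤s⁻¹ (toℕ<n k)

  Code : Set
  Code = Fin n × Fin r

  -- The vertices 0, …, top = 2n − 1 form the cycle x 0, …, x a, y 0, …, y a, where x k = k and
  -- y i = n + i.  The code (k , 0) is the cycle edge x k — x (k + 1), with x n = y 0; the code
  -- (k , 1) is y k — y (k + 1), with y n = x 0; and (k , 2 + j) is the j-th of the r − 2
  -- parallel chords x k — y (a − k).
  afterY : (k : ℕ) → Dec (k ≡ a) → ℕ
  afterY k (yes _) = 0
  afterY k (no _)  = suc (n + k)

  end₁ end₂ : Code → ℕ
  end₁ (k , fzero)          = toℕ k
  end₁ (k , fsuc fzero)     = n + toℕ k
  end₁ (k , fsuc (fsuc _))  = toℕ k
  end₂ (k , fzero)          = suc (toℕ k)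
  end₂ (k , fsuc fzero)     = afterY (toℕ k) (toℕ k ≟ a)
  end₂ (k , fsuc (fsuc _))  = n + (a ∸ toℕ k)

  end₁≤top : ∀ c → end₁ c ≤ top
  end₁≤top (k , fzero)         = ≤-trans (k≤a k) (m≤n+m a n)
  end₁≤top (k , fsuc fzero)    = +-monoʳ-≤ n (k≤a k)
  end₁≤top (k , fsuc (fsuc _)) = ≤-trans (k≤a k) (m≤n+m a n)

  end₂≤top : ∀ c → end₂ c ≤ top
  end₂≤top (k , fzero)         = ≤-trans (toℕ<n k) (m≤m+n n a)
  end₂≤top (k , fsuc fzero)    with toℕ k ≟ a
  ... | yes _  = z≤n
  ... | no k≢a = subst (_≤ top) (+-suc n (toℕ k)) (+-monoʳ-≤ n (≤∧≢⇒< (k≤a k) k≢a))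
  end₂≤top (k , fsuc (fsuc _)) = +-monoʳ-≤ n (m∸n≤m a (toℕ k))

  end₁≢end₂ : ∀ c → end₁ c ≢ end₂ c
  end₁≢end₂ (k , fzero)         = <⇒≢ (n<1+n _)
  end₁≢end₂ (k , fsuc fzero)    with toℕ k ≟ a
  ... | yes _ = 1+n≢0
  ... | no _  = <⇒≢ (n<1+n _)
  end₁≢end₂ (k , fsuc (fsuc _)) = <⇒≢ (≤-trans (toℕ<n k) (m≤m+n n _))

  decode : Fin (n * r) → Code
  decode = remQuot r

  edge : Code → Fin (n * r)
  edge = uncurry combine

  decode-edge : ∀ c → decode (edge c) ≡ c
  decode-edge (k , m) = remQuot-combine k m

  decode-injective : ∀ {e f} → decode e ≡ decode f → e ≡ f
  decode-injective {e} {f} eq =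
    trans (sym (combine-remQuot {n} r e)) (trans (cong edge eq) (combine-remQuot {n} r f))

  G : Multigraph
  G = record
    { nV       = 2 * n
    ; nE       = n * r
    ; ends     = λ e → vertex _ (end₁≤top (decode e)) , vertex _ (end₂≤top (decode e))
    ; loopless = λ e eq → end₁≢end₂ (decode e)
                   (trans (sym (toℕ-fromℕ< _)) (trans (cong toℕ eq) (toℕ-fromℕ< _)))
    }

  IncidentAt : Code → ℕ → Set
  IncidentAt c p = end₁ c ≡ p ⊎ end₂ c ≡ p

  incident⇒incidentAt : ∀ e {v} → Incident G e v → IncidentAt (decode e) (toℕ v)
  incident⇒incidentAt _ (inj₁ eq) = inj₁ (trans (sym (toℕ-fromℕ< _)) (cong toℕ eq))
  incident⇒incidentAt _ (inj₂ eq) = inj₂ (trans (sym (toℕ-fromℕ< _)) (cong toℕ eq))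

  incidentAt⇒incident : ∀ {e v} → IncidentAt (decode e) (toℕ v) → Incident G e v
  incidentAt⇒incident (inj₁ eq) = inj₁ (toℕ-injective (trans (toℕ-fromℕ< _) eq))
  incidentAt⇒incident (inj₂ eq) = inj₂ (toℕ-injective (trans (toℕ-fromℕ< _) eq))

  incident-edge : ∀ c {v} → IncidentAt c (toℕ v) → Incident G (edge c) v
  incident-edge c i =
    incidentAt⇒incident {edge c} (subst (λ c' → IncidentAt c' _) (sym (decode-edge c)) i)

  afterY-last : ∀ {k} (d : Dec (k ≡ a)) → k ≡ a → afterY k d ≡ 0
  afterY-last (yes _)  _   = refl
  afterY-last (no k≢a) k≡a = ⊥-elim (k≢a k≡a)

  afterY-below : ∀ {k} (d : Dec (k ≡ a)) → k < a → afterY k d ≡ n + suc k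
  afterY-below (yes k≡a) k<a = ⊥-elim (<⇒≢ k<a k≡a)
  afterY-below {k} (no _) _  = sym (+-suc n k)

  floor : ℕ → ℕ
  floor L = suc (L * s)

  floor-suc : ∀ L → floor (suc L) ≡ floor L + s
  floor-suc L = cong suc (+-comm s (L * s))

  color : Code → ℕ
  color (k , fzero)         = floor (suc (toℕ k))
  color (k , fsuc fzero)    = floor (a ∸ toℕ k)
  color (k , fsuc (fsuc j)) = floor (toℕ k) + suc (toℕ j)

  -- level p = min p (2n − 1 − p); the colors at vertex p are exactly floor (level p) + o, o ≤ s.
  level : ℕ → ℕ
  level p with p <? n
  ... | yes _ = p
  ... | no _  = a ∸ (p ∸ n)

  level-x : ∀ {p} → p < n → level p ≡ p
  level-x {p} p<n with p <? n
  ... | yes _  = refl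
  ... | no p≮n = ⊥-elim (p≮n p<n)

  level-y : ∀ i → level (n + i) ≡ a ∸ i
  level-y i with n + i <? n
  ... | yes n+i<n = ⊥-elim (m+n≮m n i n+i<n)
  ... | no _      = cong (a ∸_) (m+n∸m≡n n i)

  level≤a : ∀ p → level p ≤ a
  level≤a p with p <? n
  ... | yes p<n = s≤s⁻¹ p<n
  ... | no _    = m∸n≤m a (p ∸ n)

  data InWindow (p c : ℕ) : Set where
    window : ∀ o → o ≤ s → c ≡ floor (level p) + o → InWindow p c

  inWindow : ∀ {p L c} o → level p ≡ L → o ≤ s → c ≡ floor L + o → InWindow p c
  inWindow o refl o≤s c≡ = window o o≤s c≡

  floor+0 : ∀ L → floor L ≡ floor L + 0
  floor+0 L = sym (+-identityʳ (floor L))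

  j<s : (j : Fin b) → suc (toℕ j) < s
  j<s j = s≤s (toℕ<n j)

  color-inWindow : ∀ c {p} → IncidentAt c p → InWindow p (color c)
  color-inWindow (k , fzero) (inj₁ refl) = inWindow s (level-x (toℕ<n k)) ≤-refl (floor-suc (toℕ k))
  color-inWindow (k , fzero) (inj₂ refl) with toℕ k ≟ a
  ... | no k≢a  = inWindow 0 (level-x (s≤s (≤∧≢⇒< (k≤a k) k≢a))) z≤n (floor+0 (suc (toℕ k)))
  ... | yes k≡a = inWindow s level≡a ≤-refl (trans (cong (λ i → floor (suc i)) k≡a) (floor-suc a))
    where
    level≡a : level (suc (toℕ k)) ≡ a
    level≡a = trans (cong level (trans (cong suc k≡a) (sym (+-identityʳ n)))) (level-y 0)
  color-inWindow (k , fsuc fzero) (inj₁ refl) = inWindow 0 (level-y (toℕ k)) z≤n (floor+0 (a ∸ toℕ k))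
  color-inWindow (k , fsuc fzero) (inj₂ refl) with toℕ k ≟ a
  ... | yes k≡a = inWindow 0 (level-x (s≤s z≤n)) z≤n
                    (trans (cong (λ i → floor (a ∸ i)) k≡a) (cong floor (n∸n≡0 a)))
  ... | no k≢a  = inWindow s (trans (cong level (sym (+-suc n (toℕ k)))) (level-y (suc (toℕ k)))) ≤-refl
                    (trans (cong floor (+-∸-assoc 1 k<a)) (floor-suc (a ∸ suc (toℕ k))))
    where k<a = ≤∧≢⇒< (k≤a k) k≢a
  color-inWindow (k , fsuc (fsuc j)) (inj₁ refl) =
    inWindow (suc (toℕ j)) (level-x (toℕ<n k)) (<⇒≤ (j<s j)) refl
  color-inWindow (k , fsuc (fsuc j)) (inj₂ refl) =
    inWindow (suc (toℕ j)) (trans (level-y (a ∸ toℕ k)) (m∸[m∸n]≡n (k≤a k))) (<⇒≤ (j<s j)) refl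

  floor+-injective : ∀ {L L' o o'} → o < s → o' < s → floor L + o ≡ floor L' + o' → L ≡ L' × o ≡ o'
  floor+-injective {L} {L'} {o} {o'} o<s o'<s eq =
    *-cancelʳ-≡ L L' s (+-cancelˡ-≡ o (L * s) (L' * s) Ls≡L's) , o≡o'
    where
    eq' : o + L * s ≡ o' + L' * s
    eq' = trans (+-comm o (L * s)) (trans (suc-injective eq) (+-comm (L' * s) o'))
    o≡o' : o ≡ o'
    o≡o' = begin
      o                  ≡⟨ sym (m<n⇒m%n≡m o<s) ⟩
      o % s              ≡⟨ sym ([m+kn]%n≡m%n o L s) ⟩
      (o + L * s) % s    ≡⟨ cong (_% s) eq' ⟩
      (o' + L' * s) % s  ≡⟨ [m+kn]%n≡m%n o' L' s ⟩
      o' % s             ≡⟨ m<n⇒m%n≡m o'<s ⟩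
      o'                 ∎
      where open ≡-Reasoning
    Ls≡L's : o + L * s ≡ o + L' * s
    Ls≡L's = trans eq' (cong (_+ L' * s) (sym o≡o'))

  chord≢cycle : ∀ L L' (j : Fin b) → floor L + suc (toℕ j) ≢ floor L'
  chord≢cycle L L' j eq =
    1+n≢0 (proj₂ (floor+-injective {L} {L'} (j<s j) (s≤s z≤n) (trans eq (floor+0 L'))))

  -- Equal colors force suc k = a − k', so both edges lie on opposite halves of the cycle.
  x-edge≢y-edge-at : ∀ k k' {p} → IncidentAt (k , fzero) p → IncidentAt (k' , fsuc fzero) p →
                     color (k , fzero) ≢ color (k' , fsuc fzero)
  x-edge≢y-edge-at k k' {p} ix iy eq = <⇒≱ (p<n ix) (n≤p iy)
    where
    sk≡a-k' : suc (toℕ k) ≡ a ∸ toℕ k'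
    sk≡a-k' = *-cancelʳ-≡ _ _ s (suc-injective eq)
    k'<a : toℕ k' < a
    k'<a = ≤∧≢⇒< (k≤a k') (λ k'≡a → 1+n≢0 (trans sk≡a-k' (trans (cong (a ∸_) k'≡a) (n∸n≡0 a))))
    p<n : IncidentAt (k , fzero) p → p < n
    p<n (inj₁ refl) = s≤s (<⇒≤ (≤-trans (≤-reflexive sk≡a-k') (m∸n≤m a (toℕ k'))))
    p<n (inj₂ refl) = s≤s (≤-trans (≤-reflexive sk≡a-k') (m∸n≤m a (toℕ k')))
    n≤p : IncidentAt (k' , fsuc fzero) p → n ≤ p
    n≤p (inj₁ refl) = m≤m+n n (toℕ k')
    n≤p (inj₂ eq₂)  = subst (n ≤_) (trans (sym (afterY-below (toℕ k' ≟ a) k'<a)) eq₂) (m≤m+n n _)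

  color-injective-at : ∀ {c c' p} → IncidentAt c p → IncidentAt c' p → color c ≡ color c' → c ≡ c'
  color-injective-at {k , fzero} {k' , fzero} _ _ eq =
    cong (_, fzero) (toℕ-injective (suc-injective (*-cancelʳ-≡ _ _ s (suc-injective eq))))
  color-injective-at {k , fsuc fzero} {k' , fsuc fzero} _ _ eq =
    cong (_, fsuc fzero)
      (toℕ-injective (∸-cancelˡ-≡ (k≤a k) (k≤a k') (*-cancelʳ-≡ _ _ s (suc-injective eq))))
  color-injective-at {k , fsuc (fsuc j)} {k' , fsuc (fsuc j')} _ _ eq
    with floor+-injective {toℕ k} {toℕ k'} (j<s j) (j<s j') eq
  ... | k≡k' , j≡j' =
    cong₂ (λ i i' → i , fsuc (fsuc i')) (toℕ-injective k≡k') (toℕ-injective (suc-injective j≡j'))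
  color-injective-at {k , fzero} {k' , fsuc fzero} i i' eq =
    ⊥-elim (x-edge≢y-edge-at k k' i i' eq)
  color-injective-at {k , fsuc fzero} {k' , fzero} i i' eq =
    ⊥-elim (x-edge≢y-edge-at k' k i' i (sym eq))
  color-injective-at {k , fsuc (fsuc j)} {k' , fzero} _ _ eq =
    ⊥-elim (chord≢cycle (toℕ k) (suc (toℕ k')) j eq)
  color-injective-at {k , fsuc (fsuc j)} {k' , fsuc fzero} _ _ eq =
    ⊥-elim (chord≢cycle (toℕ k) (a ∸ toℕ k') j eq)
  color-injective-at {k , fzero} {k' , fsuc (fsuc j)} _ _ eq =
    ⊥-elim (chord≢cycle (toℕ k') (suc (toℕ k)) j (sym eq))
  color-injective-at {k , fsuc fzero} {k' , fsuc (fsuc j)} _ _ eq =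
    ⊥-elim (chord≢cycle (toℕ k') (a ∸ toℕ k) j (sym eq))

  data OffsetView : ℕ → Set where
    lowest  : OffsetView 0
    highest : OffsetView s
    middle  : (j : Fin b) → OffsetView (suc (toℕ j))

  offsetView : ∀ {o} → o ≤ s → OffsetView o
  offsetView {zero}  _   = lowest
  offsetView {suc o} o≤s with m≤n⇒m<n∨m≡n o≤s
  ... | inj₂ refl = highest
  ... | inj₁ o<s  = subst OffsetView (cong suc (toℕ-fromℕ< o<b)) (middle (fromℕ< o<b))
    where o<b = s≤s⁻¹ o<s

  ColorOccursAt : ℕ → ℕ → Set
  ColorOccursAt p c = ∃ λ code → IncidentAt code p × color code ≡ c

  occurs-x : ∀ {o} (k : Fin n) → OffsetView o → ColorOccursAt (toℕ k) (floor (toℕ k) + o)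
  occurs-x fzero lowest =
    (fromℕ a , fsuc fzero) , inj₂ (afterY-last (toℕ (fromℕ a) ≟ a) (toℕ-fromℕ a)) ,
    trans (cong (λ i → floor (a ∸ i)) (toℕ-fromℕ a)) (cong floor (n∸n≡0 a))
  occurs-x (fsuc k) lowest =
    (inject₁ k , fzero) , inj₂ (cong suc (toℕ-inject₁ k)) ,
    trans (cong (λ i → floor (suc i)) (toℕ-inject₁ k)) (floor+0 (suc (toℕ k)))
  occurs-x k highest    = (k , fzero) , inj₁ refl , floor-suc (toℕ k)
  occurs-x k (middle j) = (k , fsuc (fsuc j)) , inj₁ refl , refl

  occurs-y : ∀ {o} (i : Fin n) → OffsetView o → ColorOccursAt (n + toℕ i) (floor (a ∸ toℕ i) + o)
  occurs-y i lowest = (i , fsuc fzero) , inj₁ refl , floor+0 (a ∸ toℕ i)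
  occurs-y fzero highest =
    (fromℕ a , fzero) , inj₂ (cong suc (trans (toℕ-fromℕ a) (sym (+-identityʳ a)))) ,
    trans (cong (λ i → floor (suc i)) (toℕ-fromℕ a)) (floor-suc a)
  occurs-y (fsuc i) highest =
    (inject₁ i , fsuc fzero) ,
    inj₂ (trans (afterY-below (toℕ (inject₁ i) ≟ a) (subst (_< a) (sym (toℕ-inject₁ i)) (toℕ<n i)))
                (cong (λ i' → n + suc i') (toℕ-inject₁ i))) ,
    trans (cong (λ i' → floor (a ∸ i')) (toℕ-inject₁ i))
          (trans (cong floor (+-∸-assoc 1 (toℕ<n i))) (floor-suc (a ∸ suc (toℕ i))))
  occurs-y i (middle j) =
    (fromℕ< k<n , fsuc (fsuc j)) ,
    inj₂ (cong (n +_) (trans (cong (a ∸_) (toℕ-fromℕ< k<n)) (m∸[m∸n]≡n (k≤a i)))) ,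
    cong (λ k' → floor k' + suc (toℕ j)) (toℕ-fromℕ< k<n)
    where
    k<n : a ∸ toℕ i < n
    k<n = s≤s (m∸n≤m a (toℕ i))

  data Position : ℕ → Set where
    x : (k : Fin n) → Position (toℕ k)
    y : (i : Fin n) → Position (n + toℕ i)

  position : ∀ {p} → p ≤ top → Position p
  position {p} p≤top with p <? n
  ... | yes p<n = subst Position (toℕ-fromℕ< p<n) (x (fromℕ< p<n))
  ... | no p≮n  =
    subst Position (trans (cong (n +_) (toℕ-fromℕ< i<n)) (m+[n∸m]≡n (≮⇒≥ p≮n))) (y (fromℕ< i<n))
    where
    i<n : p ∸ n < n
    i<n = s≤s (≤-trans (∸-monoˡ-≤ n p≤top) (≤-reflexive (m+n∸m≡n n a)))

  color-occurs : ∀ {p o} → p ≤ top → o ≤ s → ColorOccursAt p (floor (level p) + o)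
  color-occurs {o = o} p≤top o≤s with position p≤top
  ... | x k = subst (λ L → ColorOccursAt (toℕ k) (floor L + o)) (sym (level-x (toℕ<n k)))
                (occurs-x k (offsetView o≤s))
  ... | y i = subst (λ L → ColorOccursAt (n + toℕ i) (floor L + o)) (sym (level-y (toℕ i)))
                (occurs-y i (offsetView o≤s))

  α : Fin (n * r) → ℕ
  α e = color (decode e)

  α-edge : ∀ c → α (edge c) ≡ color c
  α-edge c = cong color (decode-edge c)

  α-inWindow : ∀ {e v} → Incident G e v → InWindow (toℕ v) (α e)
  α-inWindow {e} ie = color-inWindow (decode e) (incident⇒incidentAt e ie)

  α-proper : ∀ e f v → Incident G e v → Incident G f v → α e ≡ α f → e ≡ f
  α-proper e f v ie if eq =
    decode-injective (color-injective-at (incident⇒incidentAt e ie) (incident⇒incidentAt f if) eq)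

  occurs-at-vertex : ∀ v {o} → o ≤ s → ∃ λ e → Incident G e v × α e ≡ floor (level (toℕ v)) + o
  occurs-at-vertex v o≤s with color-occurs (toℕ≤top v) o≤s
  ... | code , i , color≡ = edge code , incident-edge code i , trans (α-edge code) color≡

  inWindow≤floor-n : ∀ {p c} → InWindow p c → c ≤ floor n
  inWindow≤floor-n {p} (window o o≤s refl) =
    ≤-trans (+-mono-≤ (s≤s (*-monoˡ-≤ s (level≤a p))) o≤s) (≤-reflexive (sym (floor-suc a)))

  1≤color : ∀ c → 1 ≤ color c
  1≤color (_ , fzero)         = s≤s z≤n
  1≤color (_ , fsuc fzero)    = s≤s z≤n
  1≤color (_ , fsuc (fsuc _)) = s≤s z≤n

  decompose : ∀ m d → d ≤ suc m * s → ∃ λ L → L ≤ m × ∃ λ o → o ≤ s × d ≡ L * s + o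
  decompose m d d≤ with d ≤? s
  ... | yes d≤s = 0 , z≤n , d , d≤s , refl
  decompose zero    d d≤ | no d≰s = ⊥-elim (d≰s (subst (d ≤_) (+-identityʳ s) d≤))
  decompose (suc m) d d≤ | no d≰s
    with decompose m (d ∸ s) (subst (d ∸ s ≤_) (m+n∸m≡n s _) (∸-monoˡ-≤ s d≤))
  ... | L , L≤m , o , o≤s , d-s≡ =
    suc L , s≤s L≤m , o , o≤s ,
    trans (sym (m+[n∸m]≡n (<⇒≤ (≰⇒> d≰s)))) (trans (cong (s +_) d-s≡) (sym (+-assoc s (L * s) o)))

  coloring : IntervalColoring G (floor n)
  coloring = record
    { α        = α
    ; inRange  = λ e → 1≤color (decode e) , inWindow≤floor-n (α-inWindow {e} (inj₁ refl))
    ; proper   = α-proper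
    ; allUsed  = allUsed
    ; interval = interval
    }
    where
    allUsed : ∀ c → 1 ≤ c → c ≤ floor n → ∃ λ e → α e ≡ c
    allUsed (suc d) _ c≤ with decompose a d (s≤s⁻¹ c≤)
    ... | L , L≤a , o , o≤s , refl with occurs-at-vertex (vertex L (≤-trans L≤a (m≤n+m a n))) o≤s
    ...   | e , _ , αe≡ = e , trans αe≡ (cong (λ l → floor l + o) level≡L)
      where
      level≡L : level (toℕ (vertex L (≤-trans L≤a (m≤n+m a n)))) ≡ L
      level≡L = trans (cong level (toℕ-vertex L (≤-trans L≤a (m≤n+m a n)))) (level-x (s≤s L≤a))
    interval : ∀ v e f c → Incident G e v → Incident G f v → α e ≤ c → c ≤ α f →
               ∃ λ g → Incident G g v × α g ≡ c
    interval v e f c ie if αe≤c c≤αf with α-inWindow {e} ie | α-inWindow {f} if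
    ... | window o₁ _ αe≡ | window o₂ o₂≤s αf≡ =
      let base = floor (level (toℕ v))
          base≤c : base ≤ c
          base≤c = ≤-trans (m≤m+n base o₁) (≤-trans (≤-reflexive (sym αe≡)) αe≤c)
          c-base≤s : c ∸ base ≤ s
          c-base≤s = ≤-trans (∸-monoˡ-≤ base (≤-trans c≤αf (≤-reflexive αf≡)))
                             (≤-trans (≤-reflexive (m+n∸m≡n base o₂)) o₂≤s)
          (g , ig , αg≡) = occurs-at-vertex v c-base≤s
      in g , ig , trans αg≡ (m+[n∸m]≡n base≤c)

  degree≡r : ∀ v → degree G v ≡ r
  degree≡r v = ≤-antisym degree≤r r≤degree
    where
    base = floor (level (toℕ v))
    degree≤r : degree G v ≤ r
    degree≤r = degree-≤-window G v α (λ e f → α-proper e f v) base r offset<r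
      where
      offset<r : ∀ e → Incident G e v → ∃ λ o → o < r × α e ≡ base + o
      offset<r e ie with α-inWindow {e} ie
      ... | window o o≤s αe≡ = o , s≤s o≤s , αe≡
    r≤degree : r ≤ degree G v
    r≤degree with occurs-at-vertex v z≤n | occurs-at-vertex v ≤-refl
    ... | e₀ , ie₀ , αe₀≡ | eₛ , ieₛ , αeₛ≡ = +-cancelˡ-≤ base r (degree G v) (begin
      base + suc s            ≡⟨ +-suc base s ⟩
      suc (base + s)          ≡⟨ cong suc (sym αeₛ≡) ⟩
      suc (α eₛ)              ≤⟨ color-span-<-degree coloring e₀ eₛ ie₀ ieₛ αe₀≤αeₛ ⟩
      α e₀ + degree G v       ≡⟨ cong (_+ degree G v) (trans αe₀≡ (+-identityʳ base)) ⟩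
      base + degree G v       ∎)
      where
      open ≤-Reasoning
      αe₀≤αeₛ : α e₀ ≤ α eₛ
      αe₀≤αeₛ = subst₂ _≤_ (sym αe₀≡) (sym αeₛ≡) (+-monoʳ-≤ base z≤n)

  cycle-edge : ∀ p → suc p ≤ top → ∃ λ c → IncidentAt c p × IncidentAt c (suc p)
  cycle-edge p sp≤top with position (≤-trans (n≤1+n p) sp≤top)
  ... | x k = (k , fzero) , inj₁ refl , inj₂ refl
  ... | y i = (i , fsuc fzero) , inj₁ refl ,
              inj₂ (trans (afterY-below (toℕ i ≟ a) (+-cancelˡ-< n (toℕ i) a sp≤top))
                          (+-suc n (toℕ i)))

  wrap-edge : ∃ λ c → IncidentAt c top × IncidentAt c 0
  wrap-edge = (fromℕ a , fsuc fzero) , inj₁ (cong (n +_) (toℕ-fromℕ a)) ,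
              inj₂ (afterY-last (toℕ (fromℕ a) ≟ a) (toℕ-fromℕ a))

  first last : Fin (2 * n)
  first = fzero
  last  = vertex top ≤-refl

  Segment : (Fin (2 * n) → Set) → ℕ → ℕ → Set
  Segment P i j = ∀ v → i ≤ toℕ v → toℕ v ≤ j → P v

  ascending : ∀ {P} m {u v} → toℕ u + m ≡ toℕ v → Segment P (toℕ u) (toℕ v) → Walk G P u v m
  ascending {P} zero {u} {v} u+0≡v seg =
    subst (λ w → Walk G P u w 0) (toℕ-injective (trans (sym (+-identityʳ _)) u+0≡v))
      (here (seg u ≤-refl (≤-trans (m≤m+n _ 0) (≤-reflexive u+0≡v))))
  ascending (suc m) {u} {v} u+m≡v seg =
    let c , iu , iu' = cycle-edge (toℕ u) su≤top in
    step (edge c) (seg u ≤-refl (≤-trans (m≤m+n _ (suc m)) (≤-reflexive u+m≡v)))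
      (incident-edge c iu)
      (incident-edge c (subst (IncidentAt c) (sym (toℕ-vertex _ su≤top)) iu'))
      (ascending m u'+m≡v
        (λ w u'≤w → seg w (≤-trans (n≤1+n _) (subst (_≤ toℕ w) (toℕ-vertex _ su≤top) u'≤w))))
    where
    su+m≡v : suc (toℕ u) + m ≡ toℕ v
    su+m≡v = trans (sym (+-suc _ m)) u+m≡v
    su≤top : suc (toℕ u) ≤ top
    su≤top = ≤-trans (m≤m+n _ m) (≤-trans (≤-reflexive su+m≡v) (toℕ≤top v))
    u'+m≡v : toℕ (vertex (suc (toℕ u)) su≤top) + m ≡ toℕ v
    u'+m≡v = trans (cong (_+ m) (toℕ-vertex _ su≤top)) su+m≡v

  between : ∀ {P u v} → toℕ u ≤ toℕ v → Segment P (toℕ u) (toℕ v) → Walk G P u v (toℕ v ∸ toℕ u)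
  between u≤v = ascending _ (m+[n∸m]≡n u≤v)

  around : ∀ {P u v} → Segment P 0 (toℕ u) → Segment P (toℕ v) top →
           Walk G P u v (toℕ u + suc (top ∸ toℕ v))
  around {P} {u} {v} low high =
    let c , iₜ , i₀ = wrap-edge in
    reverseʷ (ascending (toℕ u) {first} refl low) ++ʷ
    step (edge c) (low first z≤n z≤n) (incident-edge c i₀)
      (incident-edge c (subst (IncidentAt c) (sym (toℕ-vertex top ≤-refl)) iₜ))
      (reverseʷ (ascending (top ∸ toℕ v) v+≡last (λ w v≤w _ → high w v≤w (toℕ≤top w))))
    where
    v+≡last : toℕ v + (top ∸ toℕ v) ≡ toℕ last
    v+≡last = trans (m+[n∸m]≡n (toℕ≤top v)) (sym (toℕ-vertex top ≤-refl))

  connected : Connected G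
  connected u v _ _ with ≤-total (toℕ u) (toℕ v)
  ... | inj₁ u≤v = walk⇒reach (between u≤v (λ _ _ _ → tt))
  ... | inj₂ v≤u = walk⇒reach (reverseʷ (between v≤u (λ _ _ _ → tt)))

  -- When u ≤ z ≤ v the walk avoiding z goes around the cycle, through the wrap edge.
  walk-avoiding : ∀ {z u v} → ¬ (u ≡ z) → ¬ (v ≡ z) → toℕ u ≤ toℕ v →
                  ∃ λ d → Walk G (λ w → ¬ (w ≡ z)) u v d
  walk-avoiding {z} {u} {v} u≢z v≢z u≤v with toℕ z <? toℕ u | toℕ v <? toℕ z
  ... | yes z<u | _ =
    _ , between u≤v (λ w u≤w _ w≡z → <⇒≱ z<u (subst (λ y → toℕ u ≤ toℕ y) w≡z u≤w))
  ... | no _ | yes v<z =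
    _ , between u≤v (λ w _ w≤v w≡z → <⇒≱ v<z (subst (λ y → toℕ y ≤ toℕ v) w≡z w≤v))
  ... | no z≮u | no v≮z = _ , around
    (λ w _ w≤u w≡z → u≢z (toℕ-injective (≤-antisym (≮⇒≥ z≮u) (subst (λ y → toℕ y ≤ toℕ u) w≡z w≤u))))
    (λ w v≤w _ w≡z → v≢z (toℕ-injective (≤-antisym (subst (λ y → toℕ v ≤ toℕ y) w≡z v≤w) (≮⇒≥ v≮z))))

  connected-avoiding : ∀ z → ConnectedOn G (λ v → ¬ (v ≡ z))
  connected-avoiding z u v u≢z v≢z with ≤-total (toℕ u) (toℕ v)
  ... | inj₁ u≤v = walk⇒reach (proj₂ (walk-avoiding u≢z v≢z u≤v))
  ... | inj₂ v≤u = walk⇒reach (reverseʷ (proj₂ (walk-avoiding v≢z u≢z v≤u)))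

  Antipodal : Fin (2 * n) → Fin (2 * n) → Set
  Antipodal u v = toℕ u + n ≡ toℕ v ⊎ toℕ v + n ≡ toℕ u

  antipodal? : ∀ u v → Dec (Antipodal u v)
  antipodal? u v = (toℕ u + n ≟ toℕ v) ⊎-dec (toℕ v + n ≟ toℕ u)

  no-double-antipode : ∀ (u v : Fin (2 * n)) → toℕ v + n + n ≢ toℕ u
  no-double-antipode u v eq = <⇒≱ (s≤s (toℕ≤top u)) (begin
    suc top          ≡⟨ cong suc (sym (+-suc a a)) ⟩
    n + n            ≤⟨ m≤n+m (n + n) (toℕ v) ⟩
    toℕ v + (n + n)  ≡⟨ sym (+-assoc (toℕ v) n n) ⟩
    toℕ v + n + n    ≡⟨ eq ⟩
    toℕ u            ∎)
    where open ≤-Reasoning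

  antipode-unique : ∀ {w u v} → Antipodal w u → Antipodal w v → u ≡ v
  antipode-unique (inj₁ eq₁) (inj₁ eq₂) = toℕ-injective (trans (sym eq₁) eq₂)
  antipode-unique {u = u} {v} (inj₁ eq₁) (inj₂ eq₂) =
    ⊥-elim (no-double-antipode u v (trans (cong (_+ n) eq₂) eq₁))
  antipode-unique {u = u} {v} (inj₂ eq₁) (inj₁ eq₂) =
    ⊥-elim (no-double-antipode v u (trans (cong (_+ n) eq₁) eq₂))
  antipode-unique (inj₂ eq₁) (inj₂ eq₂) = toℕ-injective (+-cancelʳ-≡ n _ _ (trans eq₁ (sym eq₂)))

  around-length≤a : ∀ {u v} → u ≤ v → v ≤ top → n < v ∸ u → u + suc (top ∸ v) ≤ a
  around-length≤a {u} {v} u≤v v≤top n<v-u = +-cancelˡ-≤ (suc n) _ a (begin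
    suc n + (u + suc (top ∸ v))    ≤⟨ +-monoˡ-≤ _ n<v-u ⟩
    v ∸ u + (u + suc (top ∸ v))    ≡⟨ sym (+-assoc (v ∸ u) u _) ⟩
    v ∸ u + u + suc (top ∸ v)      ≡⟨ cong (_+ suc (top ∸ v)) (m∸n+n≡m u≤v) ⟩
    v + suc (top ∸ v)              ≡⟨ +-suc v _ ⟩
    suc (v + (top ∸ v))            ≡⟨ cong suc (m+[n∸m]≡n v≤top) ⟩
    suc n + a                      ∎)
    where open ≤-Reasoning

  -- The cycle has length 2n, so only the antipode lies further than n − 1 = a steps away.
  close-ascending : ∀ {u v} → toℕ u ≤ toℕ v → ¬ Antipodal u v → ∃ λ d → d ≤ a × Walk G (λ _ → ⊤) u v d
  close-ascending {u} {v} u≤v ¬antipodal with <-cmp (toℕ v ∸ toℕ u) n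
  ... | tri< d<n _ _ = _ , s≤s⁻¹ d<n , between u≤v (λ _ _ _ → tt)
  ... | tri≈ _ d≡n _ = ⊥-elim (¬antipodal (inj₁ (trans (cong (toℕ u +_) (sym d≡n)) (m+[n∸m]≡n u≤v))))
  ... | tri> _ _ n<d = _ , around-length≤a u≤v (toℕ≤top v) n<d , around (λ _ _ _ → tt) (λ _ _ _ → tt)

  close : ∀ {w q} → ¬ Antipodal w q → ∃ λ d → d ≤ a × Walk G (λ _ → ⊤) w q d
  close {w} {q} ¬antipodal with ≤-total (toℕ w) (toℕ q)
  ... | inj₁ w≤q = close-ascending w≤q ¬antipodal
  ... | inj₂ q≤w with close-ascending q≤w (λ antipodal → ¬antipodal (swap antipodal))
  ...   | d , d≤a , walk = d , d≤a , reverseʷ walk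

  edges-within-a : EdgesWithin G a
  edges-within-a w e with antipodal? w (proj₁ (ends G e))
  ... | no ¬antipodal = _ , inj₁ refl , close ¬antipodal
  ... | yes antipodal =
    _ , inj₂ refl , close (λ antipodal₂ → loopless G e (antipode-unique antipodal antipodal₂))

mainTheorem15 : ∀ (n r : ℕ) → 2 ≤ n → 2 ≤ r →
    Σ Multigraph (λ G → TwoConnected G × nV G ≡ 2 * n × MaxDegree G r ×
      HasIntervalColoring G × WIs G (1 + n * (r ∸ 1)))
mainTheorem15 (suc (suc a)) (suc (suc b)) _ _ =
  G , (subst (3 ≤_) (sym 2n≡suc-top) (s≤s (s≤s (s≤s z≤n))) , connected , connected-avoiding) ,
  refl ,
  ((λ v → ≤-reflexive (degree≡r v)) , first , degree≡r first) ,
  (floor n , coloring) ,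
  coloring , (λ t C → intervalColoring-bound C (λ v → ≤-reflexive (degree≡r v)) edges-within-a)
  where open Construction (suc a) b
mainTheorem15 0 _ () _
mainTheorem15 1 _ (s≤s ()) _
mainTheorem15 _ 0 _ ()
mainTheorem15 _ 1 _ (s≤s ())
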